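{- Let $G=(V,E)$ be a 3-edge-connected graph. For each $e\in E$, the vector $2\chi_{\{e\}}$ lies in the cycle lattice $\mathcal{L}(\mathcal{C}(G))$. In particular, $2\mathbb{Z}^E\subseteq\mathcal{L}(\mathcal{C}(G))$.
   Context: Graphs may have loops and parallel edges. A cycle is a connected subgraph in which every vertex has degree two, regarded as an edge set; $\mathcal{C}(G)$ is the set of cycles, $\chi_A\in\mathbb{Z}^E$ is the characteristic vector of $A\subseteq E$, and $\mathcal{L}(\mathcal{C}(G))=\{\sum_C n_C\chi_C: n_C\in\mathbb{Z}\}$. A graph is 3-edge-connected if it is connected and remains connected after deleting any at most two edges. -}

module Defs where

open import Data.Nat using (ℕ; zero; suc; _+_)
open import Data.Bool using (Bool; true; false; if_then_else_)
open import Data.Fin using (Fin; _≟_)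
open import Data.Fin.Subset using (Subset; _∈_; _∉_)
open import Data.Vec using (lookup)
open import Data.List using (List; map; allFin; foldr)
open import Data.Nat.ListAction using (sum)
open import Data.Unit using (⊤)
open import Data.Integer as ℤ using (ℤ)
open import Data.Product using (Σ; ∃; ∃-syntax; _×_; _,_; proj₁; proj₂)
open import Data.Sum using (_⊎_)
open import Relation.Nullary using (¬_; does)
open import Relation.Binary.PropositionalEquality using (_≡_; _≢_)

-- A finite multigraph (loops and parallel edges allowed):
-- vertex set Fin n, edge set Fin m, each edge has two (unordered) ends.
record Graph : Set where
  field
    n   : ℕ
    m   : ℕ
    ends : Fin m → Fin n × Fin n
open Graph public

Vertex : Graph → Set
Vertex G = Fin (n G)

Edge : Graph → Set
Edge G = Fin (m G)

Joins : (G : Graph) → Edge G → Vertex G → Vertex G → Set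
Joins G e u w = (ends G e ≡ (u , w)) ⊎ (ends G e ≡ (w , u))

data Reach (G : Graph) (P : Edge G → Set) : Vertex G → Vertex G → Set where
  here : ∀ {u} → Reach G P u u
  step : ∀ {u w v} (e : Edge G) → P e → Joins G e u w → Reach G P w v → Reach G P u v

Connected : Graph → Set
Connected G = ∀ (u v : Vertex G) → Reach G (λ _ → ⊤) u v

-- G is 3-edge-connected: connected, and connected after deleting any
-- at most two edges (deleting e and f, possibly e = f)
ThreeEdgeConnected : Graph → Set
ThreeEdgeConnected G =
  Connected G ×
  (∀ (e f : Edge G) (u v : Vertex G) → Reach G (λ d → (d ≢ e) × (d ≢ f)) u v)

EdgeSet : Graph → Set
EdgeSet G = Subset (m G)

-- number of ends of e at v (a loop at v contributes 2)
endCount : (G : Graph) → Edge G → Vertex G → ℕ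
endCount G e v =
  (if does (proj₁ (ends G e) ≟ v) then 1 else 0) +
  (if does (proj₂ (ends G e) ≟ v) then 1 else 0)

degree : (G : Graph) → EdgeSet G → Vertex G → ℕ
degree G S v = sum (map (λ e → if lookup S e then endCount G e v else 0) (allFin (m G)))

Touches : (G : Graph) → EdgeSet G → Vertex G → Set
Touches G S v = ∃[ e ] (e ∈ S × ∃[ w ] Joins G e v w)

IsCycle : (G : Graph) → EdgeSet G → Set
IsCycle G S =
  (∃[ e ] e ∈ S) ×
  (∀ v → Touches G S v → degree G S v ≡ 2) ×
  (∀ u v → Touches G S u → Touches G S v → Reach G (λ e → e ∈ S) u v)

χ : (G : Graph) → EdgeSet G → Edge G → ℤ
χ G A e = if lookup A e then ℤ.+ 1 else ℤ.+ 0

-- the cycle lattice L(C(G)): finite integer combinations of characteristic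
-- vectors of cycles, given as a list of (coefficient, cycle) pairs
InCycleLattice : (G : Graph) → (Edge G → ℤ) → Set
InCycleLattice G x =
  ∃[ cs ] (∀ (e : Edge G) →
    foldr (λ (c : ℤ × Σ (EdgeSet G) (IsCycle G)) acc →
             proj₁ c ℤ.* χ G (proj₁ (proj₂ c)) e ℤ.+ acc)
          (ℤ.+ 0) cs ≡ x e)

singletonE : (G : Graph) → Edge G → EdgeSet G
singletonE G e = Data.Fin.Subset.⁅ e ⁆

module Submission where

open import Defs
open import Data.Integer using (ℤ; _*_; +_)
open import Data.Product using (_×_)

open import Algebra.Bundles using (Monoid)
import Algebra.Properties.CommutativeMonoid.Sum as CommutativeMonoidSum
import Algebra.Properties.Monoid.Sum
open import Data.Bool using (true; false; if_then_else_; _∨_; T)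
open import Data.Bool.Properties using (T-≡)
open import Data.Empty using (⊥; ⊥-elim)
open import Data.Fin using (Fin; zero; suc; _≟_)
open import Data.Fin.Subset as Subset using (Subset; ⁅_⁆; _∪_)
open import Data.Fin.Subset.Properties using (x∈⁅y⁆⇒x≡y; x∈⁅x⁆; x∈p∪q⁺; x∈p∪q⁻; ∉⊥)
import Data.Integer as ℤ
import Data.Integer.Properties as ℤ
import Data.Integer.Tactic.RingSolver as ℤSolver
open import Data.List using (List; []; _∷_; _++_; _∷ʳ_; map; allFin; tabulate; foldr)
open import Data.List.Properties using (map-tabulate; ++-assoc)
open import Data.List.Membership.Propositional using (_∈_; _∉_)
open import Data.List.Membership.Propositional.Properties using (∈-++⁺ˡ; ∈-++⁺ʳ; ∈-++⁻)
open import Data.List.Relation.Binary.Disjoint.Propositional using (Disjoint)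
open import Data.List.Relation.Binary.Permutation.Propositional
  using (_↭_; ↭-refl; ↭-prep; ↭-sym; ↭⇒↭ₛ; module PermutationReasoning)
open import Data.List.Relation.Binary.Permutation.Propositional.Properties using (∷↭∷ʳ; All-resp-↭; ∈-resp-↭)
open import Data.List.Relation.Binary.Permutation.Setoid.Properties using (Unique-resp-↭)
open import Data.List.Relation.Unary.All as All using (All; []; _∷_)
import Data.List.Relation.Unary.All.Properties as All
open import Data.List.Relation.Unary.Any using (here; there)
open import Data.List.Relation.Unary.Unique.Propositional as Unique using (Unique; []; _∷_)
open import Data.List.Relation.Unary.Unique.Propositional.Properties using (Unique[x∷xs]⇒x∉xs; ++⁺)
open import Data.Nat using (ℕ; zero; suc; _+_)
import Data.Nat as ℕ
import Data.Nat.Properties as ℕₚ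
open import Data.Nat.ListAction using (sum)
open import Data.Nat.Tactic.RingSolver using (solve-∀)
open import Data.Product using (Σ; Σ-syntax; _,_; proj₁; proj₂; map₁; map₂)
open import Data.Sum as Sum using (_⊎_; inj₁; inj₂)
open import Data.Vec using (lookup)
open import Data.Vec.Properties using (lookup-replicate; lookup-zipWith; lookup⇒[]=)
open import Function using (_∘_)
open import Function.Bundles using (Equivalence)
open import Relation.Nullary using (does; yes; no; ¬_)
open import Relation.Nullary.Decidable using (dec-true; dec-false)
open import Relation.Unary using (Decidable)
open import Relation.Binary.PropositionalEquality
  using (_≡_; _≢_; refl; sym; trans; cong; cong₂; subst; setoid; module ≡-Reasoning)

-- Let e = uv.  Since G − e stays connected after deleting any further edge, a closed
-- trail in G − e through u can be grown along a u–v walk by attaching ears, until it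
-- passes through v.  Splitting it at v into Z₂ : u → v and Z₁ : v → u, the closed trails
-- e Z₁ and Z₂ e satisfy χ(e Z₁) + χ(Z₂ e) − χ(Z₂ Z₁) = 2χ_e.  Every closed trail lies in the
-- cycle lattice, because erasing its loops one at a time splits it into edge-disjoint
-- cycles.  Finally 2y = Σ_e y_e · 2χ_e.

Unique-++⁻ : ∀ {A : Set} (xs : List A) {ys} → Unique (xs ++ ys) →
             Unique xs × Unique ys × Disjoint xs ys
Unique-++⁻ []       u        = [] , u , λ ()
Unique-++⁻ (x ∷ xs) (x∉ ∷ u) with Unique-++⁻ xs u
... | uxs , uys , disjoint =
  All.++⁻ˡ xs x∉ ∷ uxs , uys ,
  λ { (here refl , x∈ys) → All.lookup (All.++⁻ʳ xs x∉) x∈ys refl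
    ; (there v∈xs , v∈ys) → disjoint (v∈xs , v∈ys) }

Unique-replaceMiddle : ∀ {A : Set} (as bs cs qs : List A) → Unique (as ++ bs ++ cs) → Unique qs →
                       Disjoint qs (as ++ bs ++ cs) → Unique (as ++ qs ++ cs)
Unique-replaceMiddle as bs cs qs u uqs fresh
  with uas , ubcs , as#bcs ← Unique-++⁻ as u
  with _ , ucs , _ ← Unique-++⁻ bs ubcs
  = ++⁺ uas (++⁺ uqs ucs λ (v∈qs , v∈cs) → fresh (v∈qs , ∈-++⁺ʳ as (∈-++⁺ʳ bs v∈cs)))
        λ (v∈as , v∈qcs) → Sum.[ (λ v∈qs → fresh (v∈qs , ∈-++⁺ˡ v∈as))
                               , (λ v∈cs → as#bcs (v∈as , ∈-++⁺ʳ bs v∈cs)) ]′ (∈-++⁻ qs v∈qcs)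

module _ {c ℓ} (M : Monoid c ℓ) where
  open Monoid M
    using (Carrier; _≈_; _∙_; ε; identityˡ; identityʳ; ∙-congˡ; reflexive)
    renaming (sym to ≈-sym; trans to ≈-trans)
  open import Algebra.Properties.Monoid.Sum M using (sum-syntax; sum-cong-≗; sum-replicate-zero)

  if-∨ : ∀ a b x → (T a → T b → ⊥) →
         (if a ∨ b then x else ε) ≈ (if a then x else ε) ∙ (if b then x else ε)
  if-∨ true  true  x disjoint = ⊥-elim (disjoint _ _)
  if-∨ true  false x _ = ≈-sym (identityʳ x)
  if-∨ false true  x _ = ≈-sym (identityˡ x)
  if-∨ false false x _ = ≈-sym (identityˡ ε)

  sum-⊥ : ∀ {m} (f : Fin m → Carrier) →
          ∑[ i < m ] (if lookup Subset.⊥ i then f i else ε) ≈ ε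
  sum-⊥ {m} f = ≈-trans
    (reflexive (sum-cong-≗ (λ i → cong (λ b → if b then f i else ε) (lookup-replicate i false))))
    (sum-replicate-zero m)

  sum-⁅⁆ : ∀ {m} (d : Fin m) (f : Fin m → Carrier) →
           ∑[ i < m ] (if lookup ⁅ d ⁆ i then f i else ε) ≈ f d
  sum-⁅⁆ zero    f = ≈-trans (∙-congˡ (sum-⊥ (f ∘ suc))) (identityʳ (f zero))
  sum-⁅⁆ (suc d) f = ≈-trans (identityˡ _) (sum-⁅⁆ d (f ∘ suc))

open CommutativeMonoidSum ℕₚ.+-0-commutativeMonoid using (sum-syntax; sum-cong-≗; ∑-distrib-+)

sum-map-allFin : ∀ {m} (f : Fin m → ℕ) → sum (map f (allFin m)) ≡ ∑[ i < m ] f i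
sum-map-allFin {m} f = trans (cong sum (map-tabulate (λ i → i) f)) (sum-tabulate f)
  where
  sum-tabulate : ∀ {k} (g : Fin k → ℕ) → sum (tabulate g) ≡ ∑[ i < k ] g i
  sum-tabulate {zero}  g = refl
  sum-tabulate {suc k} g = cong (_+_ (g zero)) (sum-tabulate (g ∘ suc))

module ℤΣ = Algebra.Properties.Monoid.Sum ℤ.+-0-monoid

lookup-⁅⁆-comm : ∀ {k} (i j : Fin k) → lookup ⁅ i ⁆ j ≡ lookup ⁅ j ⁆ i
lookup-⁅⁆-comm zero    zero    = refl
lookup-⁅⁆-comm zero    (suc j) = lookup-replicate j false
lookup-⁅⁆-comm (suc i) zero    = sym (lookup-replicate i false)
lookup-⁅⁆-comm (suc i) (suc j) = lookup-⁅⁆-comm i j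

basis-expansion : ∀ {k} (x : Fin k → ℤ) j → ℤΣ.sum (λ i → x i * (if lookup ⁅ i ⁆ j then + 1 else + 0)) ≡ x j
basis-expansion x j = trans (ℤΣ.sum-cong-≗ coordinate) (sum-⁅⁆ ℤ.+-0-monoid j x)
  where
  coordinate : ∀ i → x i * (if lookup ⁅ i ⁆ j then + 1 else + 0) ≡ (if lookup ⁅ j ⁆ i then x i else + 0)
  coordinate i rewrite lookup-⁅⁆-comm i j with lookup ⁅ j ⁆ i
  ... | true  = ℤ.*-identityʳ (x i)
  ... | false = ℤ.*-zeroʳ (x i)

T-lookup⇒∈ : ∀ {k} (S : Subset k) i → T (lookup S i) → i Subset.∈ S
T-lookup⇒∈ S i t = lookup⇒[]= i S (Equivalence.to T-≡ t)

⁅⁆-disjoint : ∀ {k} {d : Fin k} {S} → d Subset.∉ S → ∀ i → T (lookup ⁅ d ⁆ i) → T (lookup S i) → ⊥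
⁅⁆-disjoint {d = d} {S} d∉S i i∈⁅d⁆ i∈S
  with refl ← x∈⁅y⁆⇒x≡y d (T-lookup⇒∈ ⁅ d ⁆ i i∈⁅d⁆) = d∉S (T-lookup⇒∈ S i i∈S)

module _ (G : Graph) where

  private
    V = Vertex G
    E = Edge G

  open import Data.List.Membership.DecPropositional {A = V} _≟_ using (_∈?_)

  δ : V → V → ℕ
  δ x y = if does (x ≟ y) then 1 else 0

  δ-refl : ∀ x → δ x x ≡ 1
  δ-refl x rewrite dec-true (x ≟ x) refl = refl

  δ-≢ : ∀ {x y} → x ≢ y → δ x y ≡ 0
  δ-≢ {x} {y} x≢y rewrite dec-false (x ≟ y) x≢y = refl

  Joins-sym : ∀ {d a b} → Joins G d a b → Joins G d b a
  Joins-sym = Sum.swap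

  Joins-endpoint : ∀ {d a b s t} → Joins G d a b → Joins G d s t → s ≡ a ⊎ s ≡ b
  Joins-endpoint (inj₁ p) (inj₁ q) = inj₁ (cong proj₁ (trans (sym q) p))
  Joins-endpoint (inj₁ p) (inj₂ q) = inj₂ (cong proj₂ (trans (sym q) p))
  Joins-endpoint (inj₂ p) (inj₁ q) = inj₂ (cong proj₁ (trans (sym q) p))
  Joins-endpoint (inj₂ p) (inj₂ q) = inj₁ (cong proj₂ (trans (sym q) p))

  endCount-Joins : ∀ {d a b} → Joins G d a b → ∀ w → endCount G d w ≡ δ a w + δ b w
  endCount-Joins (inj₁ p) w rewrite p = refl
  endCount-Joins {a = a} {b} (inj₂ p) w rewrite p = ℕₚ.+-comm (δ b w) (δ a w)

  Cycle : Set
  Cycle = Σ (EdgeSet G) (IsCycle G)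

  -- The fold inside InCycleLattice, so InCycleLattice G x is Σ[ cs ] (∀ e → combination cs e ≡ x e).
  combination : List (ℤ × Cycle) → E → ℤ
  combination cs e = foldr (λ (c : ℤ × Cycle) acc → proj₁ c * χ G (proj₁ (proj₂ c)) e ℤ.+ acc) (+ 0) cs

  combination-++ : ∀ cs₁ cs₂ e → combination (cs₁ ++ cs₂) e ≡ combination cs₁ e ℤ.+ combination cs₂ e
  combination-++ []               cs₂ e = sym (ℤ.+-identityˡ _)
  combination-++ ((k , S , _) ∷ cs₁) cs₂ e =
    trans (cong (ℤ._+_ (k * χ G S e)) (combination-++ cs₁ cs₂ e))
          (sym (ℤ.+-assoc (k * χ G S e) (combination cs₁ e) (combination cs₂ e)))

  combination-scale : ∀ k cs e → combination (map (map₁ (k *_)) cs) e ≡ k * combination cs e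
  combination-scale k []                 e = sym (ℤ.*-zeroʳ k)
  combination-scale k ((c , S , _) ∷ cs) e = begin
    k * c * χ G S e ℤ.+ combination (map (map₁ (k *_)) cs) e
      ≡⟨ cong₂ ℤ._+_ (ℤ.*-assoc k c (χ G S e)) (combination-scale k cs e) ⟩
    k * (c * χ G S e) ℤ.+ k * combination cs e
      ≡⟨ ℤ.*-distribˡ-+ k (c * χ G S e) (combination cs e) ⟨
    k * (c * χ G S e ℤ.+ combination cs e) ∎
    where open ≡-Reasoning

  lattice-resp : ∀ {x y} → (∀ e → x e ≡ y e) → InCycleLattice G x → InCycleLattice G y
  lattice-resp x≗y (cs , x≡) = cs , λ e → trans (x≡ e) (x≗y e)

  lattice-0 : InCycleLattice G (λ _ → + 0)
  lattice-0 = [] , λ _ → refl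

  lattice-cycle : ∀ {S} → IsCycle G S → InCycleLattice G (χ G S)
  lattice-cycle {S} isCycle = (+ 1 , S , isCycle) ∷ [] , λ e → trans (ℤ.+-identityʳ _) (ℤ.*-identityˡ (χ G S e))

  lattice-+ : ∀ {x y} → InCycleLattice G x → InCycleLattice G y → InCycleLattice G (λ e → x e ℤ.+ y e)
  lattice-+ (cs₁ , x≡) (cs₂ , y≡) =
    cs₁ ++ cs₂ , λ e → trans (combination-++ cs₁ cs₂ e) (cong₂ ℤ._+_ (x≡ e) (y≡ e))

  lattice-scale : ∀ {x} k → InCycleLattice G x → InCycleLattice G (λ e → k * x e)
  lattice-scale k (cs , x≡) = map (map₁ (k *_)) cs , λ e → trans (combination-scale k cs e) (cong (k *_) (x≡ e))

  lattice-- : ∀ {x y} → InCycleLattice G x → InCycleLattice G y → InCycleLattice G (λ e → x e ℤ.- y e)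
  lattice-- {y = y} x∈ y∈ = lattice-+ x∈ (lattice-resp (λ e → ℤ.-1*i≡-i (y e)) (lattice-scale (ℤ.- + 1) y∈))

  lattice-∑ : ∀ {k} (f : Fin k → E → ℤ) → (∀ i → InCycleLattice G (f i)) →
              InCycleLattice G (λ e → ℤΣ.sum (λ i → f i e))
  lattice-∑ {zero}  f _   = lattice-0
  lattice-∑ {suc k} f f∈ℒ = lattice-+ (f∈ℒ zero) (lattice-∑ (f ∘ suc) (f∈ℒ ∘ suc))

  data Walk : V → V → Set where
    nil  : ∀ {a} → Walk a a
    cons : ∀ {a b c} (d : E) → Joins G d a b → Walk b c → Walk a c

  edges : ∀ {a b} → Walk a b → List E
  edges nil          = []
  edges (cons d _ W) = d ∷ edges W

  starts : ∀ {a b} → Walk a b → List V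
  starts nil              = []
  starts (cons {a} _ _ W) = a ∷ starts W

  vertices : ∀ {a b} → Walk a b → List V
  vertices {b = b} W = starts W ++ b ∷ []

  infixr 5 _++ʷ_
  _++ʷ_ : ∀ {a b c} → Walk a b → Walk b c → Walk a c
  nil          ++ʷ W₂ = W₂
  cons d j W₁ ++ʷ W₂ = cons d j (W₁ ++ʷ W₂)

  ++ʷ-assoc : ∀ {a b c d} (W₁ : Walk a b) (W₂ : Walk b c) (W₃ : Walk c d) →
              (W₁ ++ʷ W₂) ++ʷ W₃ ≡ W₁ ++ʷ W₂ ++ʷ W₃
  ++ʷ-assoc nil          W₂ W₃ = refl
  ++ʷ-assoc (cons d j W₁) W₂ W₃ = cong (cons d j) (++ʷ-assoc W₁ W₂ W₃)

  edges-++ʷ : ∀ {a b c} (W₁ : Walk a b) (W₂ : Walk b c) → edges (W₁ ++ʷ W₂) ≡ edges W₁ ++ edges W₂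
  edges-++ʷ nil           W₂ = refl
  edges-++ʷ (cons d j W₁) W₂ = cong (d ∷_) (edges-++ʷ W₁ W₂)

  edges-++ʷ₃ : ∀ {a b c d} (W₁ : Walk a b) (W₂ : Walk b c) (W₃ : Walk c d) →
               edges (W₁ ++ʷ W₂ ++ʷ W₃) ≡ edges W₁ ++ edges W₂ ++ edges W₃
  edges-++ʷ₃ W₁ W₂ W₃ = trans (edges-++ʷ W₁ (W₂ ++ʷ W₃)) (cong (edges W₁ ++_) (edges-++ʷ W₂ W₃))

  starts-++ʷ : ∀ {a b c} (W₁ : Walk a b) (W₂ : Walk b c) → starts (W₁ ++ʷ W₂) ≡ starts W₁ ++ starts W₂
  starts-++ʷ nil              W₂ = refl
  starts-++ʷ (cons {a} d j W₁) W₂ = cong (a ∷_) (starts-++ʷ W₁ W₂)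

  vertices-++ʷ : ∀ {a b c} (W₁ : Walk a b) (W₂ : Walk b c) → vertices (W₁ ++ʷ W₂) ≡ starts W₁ ++ vertices W₂
  vertices-++ʷ W₁ W₂ = trans (cong (_++ _) (starts-++ʷ W₁ W₂)) (++-assoc (starts W₁) (starts W₂) _)

  ∈-vertices-head : ∀ {a b} (W : Walk a b) → a ∈ vertices W
  ∈-vertices-head nil          = here refl
  ∈-vertices-head (cons _ _ W) = here refl

  ∈-vertices-last : ∀ {a b} (W : Walk a b) → b ∈ vertices W
  ∈-vertices-last W = ∈-++⁺ʳ (starts W) (here refl)

  ∈-vertices-++ʷˡ : ∀ {a b c x} (W₁ : Walk a b) (W₂ : Walk b c) → x ∈ vertices W₁ → x ∈ vertices (W₁ ++ʷ W₂)
  ∈-vertices-++ʷˡ W₁ W₂ x∈ rewrite vertices-++ʷ W₁ W₂ with ∈-++⁻ (starts W₁) x∈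
  ... | inj₁ x∈starts     = ∈-++⁺ˡ x∈starts
  ... | inj₂ (here refl) = ∈-++⁺ʳ (starts W₁) (∈-vertices-head W₂)

  ∈-vertices-++ʷʳ : ∀ {a b c x} (W₁ : Walk a b) (W₂ : Walk b c) → x ∈ vertices W₂ → x ∈ vertices (W₁ ++ʷ W₂)
  ∈-vertices-++ʷʳ W₁ W₂ x∈ rewrite vertices-++ʷ W₁ W₂ = ∈-++⁺ʳ (starts W₁) x∈

  reverseʷ : ∀ {a b} → Walk a b → Walk b a
  reverseʷ nil          = nil
  reverseʷ (cons d j W) = reverseʷ W ++ʷ cons d (Joins-sym j) nil

  edges-reverseʷ : ∀ {a b} (W : Walk a b) → edges (reverseʷ W) ↭ edges W
  edges-reverseʷ nil          = ↭-refl
  edges-reverseʷ (cons d j W) = begin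
    edges (reverseʷ W ++ʷ cons d (Joins-sym j) nil) ≡⟨ edges-++ʷ (reverseʷ W) _ ⟩
    edges (reverseʷ W) ∷ʳ d                         ↭⟨ ∷↭∷ʳ d (edges (reverseʷ W)) ⟨
    d ∷ edges (reverseʷ W)                          ↭⟨ ↭-prep d (edges-reverseʷ W) ⟩
    d ∷ edges W                                     ∎
    where open PermutationReasoning

  ∈-vertices-reverseʷ : ∀ {a b x} (W : Walk a b) → x ∈ vertices W → x ∈ vertices (reverseʷ W)
  ∈-vertices-reverseʷ nil          x∈         = x∈
  ∈-vertices-reverseʷ (cons d j W) (here refl) =
    ∈-vertices-++ʷʳ (reverseʷ W) (cons d (Joins-sym j) nil) (there (here refl))
  ∈-vertices-reverseʷ (cons d j W) (there x∈) =
    ∈-vertices-++ʷˡ (reverseʷ W) _ (∈-vertices-reverseʷ W x∈)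

  splitAt : ∀ {a b x} (W : Walk a b) → x ∈ vertices W →
            Σ[ W₁ ∈ Walk a x ] Σ[ W₂ ∈ Walk x b ] W ≡ W₁ ++ʷ W₂
  splitAt nil          (here refl) = nil , nil , refl
  splitAt (cons d j W) (here refl) = nil , cons d j W , refl
  splitAt (cons d j W) (there x∈) with W₁ , W₂ , refl ← splitAt W x∈ = cons d j W₁ , W₂ , refl

  record Segment {a b} (W : Walk a b) (x y : V) : Set where
    constructor segment
    field
      before    : Walk a x
      middle    : Walk x y
      after     : Walk y b
      decompose : W ≡ before ++ʷ middle ++ʷ after

  splitBetween : ∀ {a b x y} (W : Walk a b) → x ∈ vertices W → y ∈ vertices W →
                 Segment W x y ⊎ Segment W y x
  splitBetween W x∈ y∈ with splitAt W x∈
  ... | A , R , refl with ∈-++⁻ (starts A) (subst (_ ∈_) (vertices-++ʷ A R) y∈)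
  ... | inj₂ y∈R with B , C , refl ← splitAt R y∈R = inj₁ (segment A B C refl)
  ... | inj₁ y∈A with A₁ , B , refl ← splitAt A (∈-++⁺ˡ y∈A) =
    inj₂ (segment A₁ B R (++ʷ-assoc A₁ B R))

  splitAtFirst : ∀ {a b} {P : V → Set} → Decidable P → (W : Walk a b) → P b →
                 Σ[ x ∈ V ] P x × Σ[ W₁ ∈ Walk a x ] Σ[ W₂ ∈ Walk x b ]
                   W ≡ W₁ ++ʷ W₂ × All (¬_ ∘ P) (starts W₁)
  splitAtFirst P? nil Pb = _ , Pb , nil , nil , refl , []
  splitAtFirst {a} P? (cons d j W) Pb with P? a
  ... | yes Pa = a , Pa , nil , cons d j W , refl , []
  ... | no ¬Pa with x , Px , W₁ , W₂ , refl , off ← splitAtFirst P? W Pb =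
    x , Px , cons d j W₁ , W₂ , refl , ¬Pa ∷ off

  Joins-∈-vertices : ∀ {a b d s t} (W : Walk a b) → d ∈ edges W → Joins G d s t → s ∈ vertices W
  Joins-∈-vertices (cons d j W) (here refl) jd with Joins-endpoint j jd
  ... | inj₁ refl = here refl
  ... | inj₂ refl = there (∈-vertices-head W)
  Joins-∈-vertices (cons _ _ W) (there d∈) jd = there (Joins-∈-vertices W d∈ jd)

  Joins-∈-starts : ∀ {a b d} (W : Walk a b) → d ∈ edges W → Σ[ s ∈ V ] Σ[ t ∈ V ] Joins G d s t × s ∈ starts W
  Joins-∈-starts (cons d j W) (here refl) = _ , _ , j , here refl
  Joins-∈-starts (cons _ _ W) (there d∈) with s , t , j , s∈ ← Joins-∈-starts W d∈ = s , t , j , there s∈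

  ∉-edges : ∀ {a b d s t} (W : Walk a b) → Joins G d s t → s ∉ vertices W → d ∉ edges W
  ∉-edges W j s∉ d∈ = s∉ (Joins-∈-vertices W d∈ j)

  path⇒trail : ∀ {a b} (W : Walk a b) → Unique (vertices W) → Unique (edges W)
  path⇒trail nil          _          = []
  path⇒trail (cons d j W) (a∉ ∷ uW) =
    All.¬Any⇒All¬ (edges W) (∉-edges W j (All.All¬⇒¬Any a∉)) ∷ path⇒trail W uW

  toWalk : ∀ {P a b} → Reach G P a b → Σ[ W ∈ Walk a b ] All P (edges W)
  toWalk here             = nil , []
  toWalk (step d pd j R) with W , pW ← toWalk R = cons d j W , pd ∷ pW

  fromWalk : ∀ {P a b} (W : Walk a b) → All P (edges W) → Reach G P a b
  fromWalk nil          []        = here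
  fromWalk (cons d j W) (pd ∷ pW) = step d pd j (fromWalk W pW)

  ∈-edges-++ʷˡ : ∀ {a b c d} (W₁ : Walk a b) (W₂ : Walk b c) → d ∈ edges W₁ → d ∈ edges (W₁ ++ʷ W₂)
  ∈-edges-++ʷˡ W₁ W₂ d∈ rewrite edges-++ʷ W₁ W₂ = ∈-++⁺ˡ d∈

  ∈-edges-++ʷʳ : ∀ {a b c d} (W₁ : Walk a b) (W₂ : Walk b c) → d ∈ edges W₂ → d ∈ edges (W₁ ++ʷ W₂)
  ∈-edges-++ʷʳ W₁ W₂ d∈ rewrite edges-++ʷ W₁ W₂ = ∈-++⁺ʳ (edges W₁) d∈

  ∈-edges-++ʷ⁻ : ∀ {a b c d} (W₁ : Walk a b) (W₂ : Walk b c) → d ∈ edges (W₁ ++ʷ W₂) →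
                 d ∈ edges W₁ ⊎ d ∈ edges W₂
  ∈-edges-++ʷ⁻ W₁ W₂ d∈ rewrite edges-++ʷ W₁ W₂ = ∈-++⁻ (edges W₁) d∈

  ∈-edges-parts : ∀ {a b x d} {W : Walk a b} (W₁ : Walk a x) (W₂ : Walk x b) → W ≡ W₁ ++ʷ W₂ →
                  (d ∈ edges W₁ → d ∈ edges W) × (d ∈ edges W₂ → d ∈ edges W)
  ∈-edges-parts W₁ W₂ refl = ∈-edges-++ʷˡ W₁ W₂ , ∈-edges-++ʷʳ W₁ W₂

  trail-++ʷ⁻ : ∀ {a b c} (W₁ : Walk a b) (W₂ : Walk b c) → Unique (edges (W₁ ++ʷ W₂)) →
               Unique (edges W₁) × Unique (edges W₂) × Disjoint (edges W₁) (edges W₂)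
  trail-++ʷ⁻ W₁ W₂ = Unique-++⁻ (edges W₁) ∘ subst Unique (edges-++ʷ W₁ W₂)

  traversals : ∀ {a b} → Walk a b → E → ℤ
  traversals nil          e = + 0
  traversals (cons d _ W) e = χ G (singletonE G d) e ℤ.+ traversals W e

  traversals-++ʷ : ∀ {a b c} (W₁ : Walk a b) (W₂ : Walk b c) e →
                   traversals (W₁ ++ʷ W₂) e ≡ traversals W₁ e ℤ.+ traversals W₂ e
  traversals-++ʷ nil           W₂ e = sym (ℤ.+-identityˡ _)
  traversals-++ʷ (cons d j W₁) W₂ e =
    trans (cong (ℤ._+_ (χ G (singletonE G d) e)) (traversals-++ʷ W₁ W₂ e))
          (sym (ℤ.+-assoc (χ G (singletonE G d) e) (traversals W₁ e) (traversals W₂ e)))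

  edgeSet : ∀ {a b} → Walk a b → EdgeSet G
  edgeSet nil          = Subset.⊥
  edgeSet (cons d _ W) = ⁅ d ⁆ ∪ edgeSet W

  ∈-edgeSet⁺ : ∀ {a b d} (W : Walk a b) → d ∈ edges W → d Subset.∈ edgeSet W
  ∈-edgeSet⁺ (cons d _ W) (here refl) = x∈p∪q⁺ (inj₁ (x∈⁅x⁆ d))
  ∈-edgeSet⁺ (cons _ _ W) (there d∈)  = x∈p∪q⁺ (inj₂ (∈-edgeSet⁺ W d∈))

  ∈-edgeSet⁻ : ∀ {a b d} (W : Walk a b) → d Subset.∈ edgeSet W → d ∈ edges W
  ∈-edgeSet⁻ nil          d∈ = ⊥-elim (∉⊥ d∈)
  ∈-edgeSet⁻ (cons d _ W) d∈ with x∈p∪q⁻ ⁅ d ⁆ (edgeSet W) d∈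
  ... | inj₁ d∈⁅d⁆ = here (x∈⁅y⁆⇒x≡y d d∈⁅d⁆)
  ... | inj₂ d∈W   = there (∈-edgeSet⁻ W d∈W)

  head∉edgeSet : ∀ {a b c d} (j : Joins G d a b) (W : Walk b c) →
                 Unique (edges (cons d j W)) → d Subset.∉ edgeSet W
  head∉edgeSet j W u d∈ = Unique[x∷xs]⇒x∉xs u (∈-edgeSet⁻ W d∈)

  χ-edgeSet : ∀ {a b} (W : Walk a b) → Unique (edges W) → ∀ e → χ G (edgeSet W) e ≡ traversals W e
  χ-edgeSet nil          _ e = cong (λ b → if b then + 1 else + 0) (lookup-replicate e false)
  χ-edgeSet (cons d j W) u e = begin
    χ G (⁅ d ⁆ ∪ edgeSet W) e
      ≡⟨ cong (λ b → if b then + 1 else + 0) (lookup-zipWith _∨_ e ⁅ d ⁆ (edgeSet W)) ⟩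
    (if lookup ⁅ d ⁆ e ∨ lookup (edgeSet W) e then + 1 else + 0)
      ≡⟨ if-∨ ℤ.+-0-monoid _ _ (+ 1) (⁅⁆-disjoint (head∉edgeSet j W u) e) ⟩
    χ G ⁅ d ⁆ e ℤ.+ χ G (edgeSet W) e
      ≡⟨ cong (ℤ._+_ (χ G ⁅ d ⁆ e)) (χ-edgeSet W (Unique.tail u) e) ⟩
    traversals (cons d j W) e ∎
    where open ≡-Reasoning

  endCounts : ∀ {a b} → Walk a b → V → ℕ
  endCounts nil          w = 0
  endCounts (cons d _ W) w = endCount G d w + endCounts W w

  degree-∑ : ∀ S w → degree G S w ≡ ∑[ i < m G ] (if lookup S i then endCount G i w else 0)
  degree-∑ S w = sum-map-allFin (λ i → if lookup S i then endCount G i w else 0)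

  degree-edgeSet : ∀ {a b} (W : Walk a b) → Unique (edges W) → ∀ w → degree G (edgeSet W) w ≡ endCounts W w
  degree-edgeSet nil          _ w = trans (degree-∑ Subset.⊥ w) (sum-⊥ ℕₚ.+-0-monoid (λ i → endCount G i w))
  degree-edgeSet (cons d j W) u w = begin
    degree G (⁅ d ⁆ ∪ edgeSet W) w            ≡⟨ degree-∑ (⁅ d ⁆ ∪ edgeSet W) w ⟩
    ∑[ i < m G ] inUnion i                     ≡⟨ sum-cong-≗ split ⟩
    ∑[ i < m G ] (inD i + inW i)               ≡⟨ ∑-distrib-+ inD inW ⟩
    ∑[ i < m G ] inD i + ∑[ i < m G ] inW i    ≡⟨ cong₂ _+_ (sum-⁅⁆ ℕₚ.+-0-monoid d f)
                                                             (sym (degree-∑ (edgeSet W) w)) ⟩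
    endCount G d w + degree G (edgeSet W) w   ≡⟨ cong (_+_ (endCount G d w)) (degree-edgeSet W (Unique.tail u) w) ⟩
    endCounts (cons d j W) w                  ∎
    where
    open ≡-Reasoning
    f inUnion inD inW : E → ℕ
    f i = endCount G i w
    inUnion i = if lookup (⁅ d ⁆ ∪ edgeSet W) i then f i else 0
    inD i = if lookup ⁅ d ⁆ i then f i else 0
    inW i = if lookup (edgeSet W) i then f i else 0
    split : ∀ i → inUnion i ≡ inD i + inW i
    split i = trans (cong (λ b → if b then f i else 0) (lookup-zipWith _∨_ i ⁅ d ⁆ (edgeSet W)))
                    (if-∨ ℕₚ.+-0-monoid _ _ (f i) (⁅⁆-disjoint (head∉edgeSet j W u) i))

  visits : ∀ {a b} → Walk a b → V → ℕ
  visits nil              w = 0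
  visits (cons {a} _ _ W) w = δ a w + visits W w

  visits-∉ : ∀ {a b w} (W : Walk a b) → w ∉ starts W → visits W w ≡ 0
  visits-∉ nil          _  = refl
  visits-∉ {w = w} (cons {a} _ _ W) w∉ = cong₂ _+_ (δ-≢ {a} {w} (w∉ ∘ here ∘ sym)) (visits-∉ W (w∉ ∘ there))

  visits-unique : ∀ {a b w} (W : Walk a b) → Unique (starts W) → w ∈ starts W → visits W w ≡ 1
  visits-unique {a} (cons _ _ W) (a∉ ∷ _) (here refl) =
    cong₂ _+_ (δ-refl a) (visits-∉ W (All.All¬⇒¬Any a∉))
  visits-unique {a} {w = w} (cons _ _ W) (a∉ ∷ u) (there w∈) =
    cong₂ _+_ (δ-≢ {a} {w} (λ { refl → All.All¬⇒¬Any a∉ w∈ })) (visits-unique W u w∈)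

  handshake : ∀ {a b} (W : Walk a b) w → endCounts W w + δ a w ≡ 2 ℕ.* visits W w + δ b w
  handshake nil w = refl
  handshake {b = b} (cons {a} {c} d j W) w = begin
    endCount G d w + endCounts W w + δ a w     ≡⟨ cong (λ k → k + endCounts W w + δ a w) (endCount-Joins j w) ⟩
    δ a w + δ c w + endCounts W w + δ a w      ≡⟨ regroup (δ a w) (δ c w) (endCounts W w) ⟩
    2 ℕ.* δ a w + (endCounts W w + δ c w)      ≡⟨ cong (_+_ (2 ℕ.* δ a w)) (handshake W w) ⟩
    2 ℕ.* δ a w + (2 ℕ.* visits W w + δ b w)   ≡⟨ regroup′ (δ a w) (visits W w) (δ b w) ⟩
    2 ℕ.* (δ a w + visits W w) + δ b w         ∎
    where
    open ≡-Reasoning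
    regroup : ∀ x y z → x + y + z + x ≡ 2 ℕ.* x + (z + y)
    regroup = solve-∀
    regroup′ : ∀ x y z → 2 ℕ.* x + (2 ℕ.* y + z) ≡ 2 ℕ.* (x + y) + z
    regroup′ = solve-∀

  closedPath-isCycle : ∀ {a b d} (j : Joins G d a b) (P : Walk b a) →
                       Unique (starts (cons d j P)) → Unique (edges (cons d j P)) →
                       IsCycle G (edgeSet (cons d j P))
  closedPath-isCycle {d = d} j P uniqueStarts trail =
    (d , ∈-edgeSet⁺ K (here refl)) , degree≡2 , connected
    where
    K = cons d j P

    touches⇒∈starts : ∀ {w} → Touches G (edgeSet K) w → w ∈ starts K
    touches⇒∈starts (e , e∈ , _ , jw) with ∈-++⁻ (starts K) (Joins-∈-vertices K (∈-edgeSet⁻ K e∈) jw)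
    ... | inj₁ w∈        = w∈
    ... | inj₂ (here refl) = here refl

    degree≡2 : ∀ w → Touches G (edgeSet K) w → degree G (edgeSet K) w ≡ 2
    degree≡2 w t = begin
      degree G (edgeSet K) w ≡⟨ degree-edgeSet K trail w ⟩
      endCounts K w          ≡⟨ ℕₚ.+-cancelʳ-≡ _ (endCounts K w) (2 ℕ.* visits K w) (handshake K w) ⟩
      2 ℕ.* visits K w       ≡⟨ cong (2 ℕ.*_) (visits-unique K uniqueStarts (touches⇒∈starts t)) ⟩
      2                      ∎
      where open ≡-Reasoning

    connected : ∀ u v → Touches G (edgeSet K) u → Touches G (edgeSet K) v → Reach G (Subset._∈ edgeSet K) u v
    connected u v tu tv
      with U₁ , U₂ , eqU ← splitAt K (∈-++⁺ˡ (touches⇒∈starts tu))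
         | V₁ , V₂ , eqV ← splitAt K (∈-++⁺ˡ (touches⇒∈starts tv))
      = fromWalk (U₂ ++ʷ V₁) (All.tabulate λ e∈ → ∈-edgeSet⁺ K
          (Sum.[ proj₂ (∈-edges-parts U₁ U₂ eqU) , proj₁ (∈-edges-parts V₁ V₂ eqV) ]′
            (∈-edges-++ʷ⁻ U₂ V₁ e∈)))

  closedPath∈lattice : ∀ {a b d} (j : Joins G d a b) (P : Walk b a) →
                       Unique (starts (cons d j P)) → Unique (edges (cons d j P)) →
                       InCycleLattice G (traversals (cons d j P))
  closedPath∈lattice j P uniqueStarts trail =
    lattice-resp (χ-edgeSet (cons _ j P) trail) (lattice-cycle (closedPath-isCycle j P uniqueStarts trail))

  record LoopErasure {a b} (W : Walk a b) : Set where
    field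
      path      : Walk a b
      simple    : Unique (vertices path)
      edges⊆    : ∀ {d} → d ∈ edges path → d ∈ edges W
      remainder : Unique (edges W) → InCycleLattice G (λ e → traversals W e ℤ.- traversals path e)

  loopErase : ∀ {a b} (W : Walk a b) → LoopErasure W
  loopErase nil = record { path = nil ; simple = [] ∷ [] ; edges⊆ = λ () ; remainder = λ _ → lattice-0 }
  loopErase (cons {a} d j W) with loopErase W
  ... | record { path = P ; simple = simpleP ; edges⊆ = ⊆W ; remainder = restW } with a ∈? vertices P
  ... | no a∉P = record
    { path      = cons d j P
    ; simple    = All.¬Any⇒All¬ (vertices P) a∉P ∷ simpleP
    ; edges⊆    = λ { (here refl) → here refl ; (there d∈) → there (⊆W d∈) }
    ; remainder = λ trail → lattice-resp cancel (restW (Unique.tail trail))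
    }
    where
    cancel : ∀ e → traversals W e ℤ.- traversals P e ≡
                   traversals (cons d j W) e ℤ.- traversals (cons d j P) e
    cancel e = ring (χ G (singletonE G d) e) (traversals W e) (traversals P e)
      where
      ring : ∀ x w p → w ℤ.- p ≡ (x ℤ.+ w) ℤ.- (x ℤ.+ p)
      ring = ℤSolver.solve-∀
  ... | yes a∈P with P₁ , P₂ , refl ← splitAt P a∈P = record
    { path      = P₂
    ; simple    = simple₂
    ; edges⊆    = there ∘ ⊆W ∘ ∈-edges-++ʷʳ P₁ P₂
    ; remainder = λ trail → lattice-resp rearrange (lattice-+ (restW (Unique.tail trail)) (loop trail))
    }
    where
    splitSimple : Unique (starts P₁) × Unique (vertices P₂) × Disjoint (starts P₁) (vertices P₂)
    splitSimple = Unique-++⁻ (starts P₁) (subst Unique (vertices-++ʷ P₁ P₂) simpleP)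
    simple₂ : Unique (vertices P₂)
    simple₂ = proj₁ (proj₂ splitSimple)
    loop : Unique (edges (cons d j W)) → InCycleLattice G (traversals (cons d j P₁))
    loop trail = closedPath∈lattice j P₁
      (All.¬Any⇒All¬ (starts P₁) (λ a∈ → proj₂ (proj₂ splitSimple) (a∈ , ∈-vertices-head P₂))
        ∷ proj₁ splitSimple)
      (All.¬Any⇒All¬ (edges P₁) (λ d∈ → Unique[x∷xs]⇒x∉xs trail (⊆W (∈-edges-++ʷˡ P₁ P₂ d∈)))
        ∷ proj₁ (trail-++ʷ⁻ P₁ P₂ (path⇒trail (P₁ ++ʷ P₂) simpleP)))
    rearrange : ∀ e → (traversals W e ℤ.- traversals (P₁ ++ʷ P₂) e) ℤ.+ traversals (cons d j P₁) e ≡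
                      traversals (cons d j W) e ℤ.- traversals P₂ e
    rearrange e rewrite traversals-++ʷ P₁ P₂ e =
      ring (χ G (singletonE G d) e) (traversals W e) (traversals P₁ e) (traversals P₂ e)
      where
      ring : ∀ x w p₁ p₂ → (w ℤ.- (p₁ ℤ.+ p₂)) ℤ.+ (x ℤ.+ p₁) ≡ (x ℤ.+ w) ℤ.- p₂
      ring = ℤSolver.solve-∀

  closedTrail∈lattice : ∀ {a} (Z : Walk a a) → Unique (edges Z) → InCycleLattice G (traversals Z)
  closedTrail∈lattice Z trail with loopErase Z
  ... | record { path = nil ; remainder = remainder } =
    lattice-resp (λ e → ℤ.+-identityʳ (traversals Z e)) (remainder trail)
  ... | record { path = cons _ _ P ; simple = a∉ ∷ _ } = ⊥-elim (All.All¬⇒¬Any a∉ (∈-vertices-last P))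

  record ClosedTrail (Allowed : E → Set) (u : V) : Set where
    constructor closedTrail
    field
      walk    : Walk u u
      trail   : Unique (edges walk)
      allowed : All Allowed (edges walk)

  module _ {Allowed : E → Set} (connectedWithout : ∀ f x y → Reach G (λ d → Allowed d × d ≢ f) x y) where

    open ClosedTrail

    record Ear {u} (Z : Walk u u) (x y : V) : Set where
      field
        {end}   : V
        end∈Z   : end ∈ vertices Z
        path    : Walk x end
        trail   : Unique (edges path)
        allowed : All Allowed (edges path)
        fresh   : Disjoint (edges path) (edges Z)
        through : y ∈ vertices path

    -- Return from y to x avoiding f, erase loops and stop at the first vertex of Z: every step
    -- after f then starts off Z, so the ear shares no edge with Z.
    findEar : ∀ {u x y f} (Z : Walk u u) → x ∈ vertices Z → Allowed f → Joins G f x y → y ∉ vertices Z → Ear Z x y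
    findEar {f = f} Z x∈Z allowedF jf y∉Z
      with R , allowedR ← toWalk (connectedWithout f _ _)
      with end , end∈Z , P₁ , P₂ , split , off ← splitAtFirst (_∈? vertices Z) (LoopErasure.path (loopErase R)) x∈Z
      = record
        { end∈Z   = end∈Z
        ; path    = cons f jf P₁
        ; trail   = All.¬Any⇒All¬ (edges P₁) (λ f∈ → proj₂ (inR f∈) refl) ∷ proj₁ (trail-++ʷ⁻ P₁ P₂ trailP)
        ; allowed = allowedF ∷ All.tabulate (proj₁ ∘ inR)
        ; fresh   = λ { (here refl , f∈Z) → ∉-edges Z (Joins-sym jf) y∉Z f∈Z
                      ; (there d∈ , d∈Z) → offZ d∈ d∈Z }
        ; through = there (∈-vertices-head P₁)
        }
      where
      L : LoopErasure R
      L = loopErase R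
      trailP : Unique (edges (P₁ ++ʷ P₂))
      trailP = subst (Unique ∘ edges) split (path⇒trail _ (LoopErasure.simple L))
      inR : ∀ {d} → d ∈ edges P₁ → Allowed d × d ≢ f
      inR d∈ = All.lookup allowedR (LoopErasure.edges⊆ L (proj₁ (∈-edges-parts P₁ P₂ split) d∈))
      offZ : ∀ {d} → d ∈ edges P₁ → d ∉ edges Z
      offZ d∈ with s , t , j , s∈ ← Joins-∈-starts P₁ d∈ = ∉-edges Z j (All.lookup off s∈)

    splice : ∀ {u x y} (Z : ClosedTrail Allowed u) → Segment (walk Z) x y → (Q : Walk x y) →
             Unique (edges Q) → All Allowed (edges Q) → Disjoint (edges Q) (edges (walk Z)) →
             Σ[ Z′ ∈ ClosedTrail Allowed u ] (∀ {v} → v ∈ vertices Q → v ∈ vertices (walk Z′))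
    splice (closedTrail _ trailZ allowedZ) (segment A B C refl) Q trailQ allowedQ fresh =
      closedTrail (A ++ʷ Q ++ʷ C)
        (subst Unique (sym (edges-++ʷ₃ A Q C))
          (Unique-replaceMiddle (edges A) (edges B) (edges C) (edges Q)
            (subst Unique (edges-++ʷ₃ A B C) trailZ) trailQ (fresh ∘ map₂ (subst (_ ∈_) (sym (edges-++ʷ₃ A B C))))))
        (subst (All Allowed) (sym (edges-++ʷ₃ A Q C))
          (All.++⁺ allowedA (All.++⁺ allowedQ allowedC))) ,
      ∈-vertices-++ʷʳ A (Q ++ʷ C) ∘ ∈-vertices-++ʷˡ Q C
      where
      allowedABC : All Allowed (edges A ++ edges B ++ edges C)
      allowedABC = subst (All Allowed) (edges-++ʷ₃ A B C) allowedZ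
      allowedA : All Allowed (edges A)
      allowedA = All.++⁻ˡ (edges A) allowedABC
      allowedC : All Allowed (edges C)
      allowedC = All.++⁻ʳ (edges B) (All.++⁻ʳ (edges A) allowedABC)

    attachEar : ∀ {u x y} (Z : ClosedTrail Allowed u) → x ∈ vertices (walk Z) → Ear (walk Z) x y →
                Σ[ Z′ ∈ ClosedTrail Allowed u ] y ∈ vertices (walk Z′)
    attachEar Z x∈Z ear with splitBetween (walk Z) x∈Z (Ear.end∈Z ear)
    ... | inj₁ seg = map₂ (λ Q⊆Z′ → Q⊆Z′ (Ear.through ear))
      (splice Z seg (Ear.path ear) (Ear.trail ear) (Ear.allowed ear) (Ear.fresh ear))
    ... | inj₂ seg = map₂ (λ Q⊆Z′ → Q⊆Z′ (∈-vertices-reverseʷ Q (Ear.through ear)))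
      (splice Z seg (reverseʷ Q) trail′ allowed′ fresh′)
      where
      Q = Ear.path ear
      reversed : edges Q ↭ edges (reverseʷ Q)
      reversed = ↭-sym (edges-reverseʷ Q)
      trail′ : Unique (edges (reverseʷ Q))
      trail′ = Unique-resp-↭ (setoid E) (↭⇒↭ₛ reversed) (Ear.trail ear)
      allowed′ : All Allowed (edges (reverseʷ Q))
      allowed′ = All-resp-↭ reversed (Ear.allowed ear)
      fresh′ : Disjoint (edges (reverseʷ Q)) (edges (walk Z))
      fresh′ = Ear.fresh ear ∘ map₁ (∈-resp-↭ (edges-reverseʷ Q))

    extend : ∀ {u x y f} (Z : ClosedTrail Allowed u) → x ∈ vertices (walk Z) → Allowed f → Joins G f x y →
             Σ[ Z′ ∈ ClosedTrail Allowed u ] y ∈ vertices (walk Z′)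
    extend {y = y} Z x∈Z allowedF jf with y ∈? vertices (walk Z)
    ... | yes y∈Z = Z , y∈Z
    ... | no y∉Z  = attachEar Z x∈Z (findEar (walk Z) x∈Z allowedF jf y∉Z)

    grow : ∀ {u x v} (Z : ClosedTrail Allowed u) → x ∈ vertices (walk Z) → (W : Walk x v) → All Allowed (edges W) →
           Σ[ Z′ ∈ ClosedTrail Allowed u ] v ∈ vertices (walk Z′)
    grow Z x∈Z nil          []                   = Z , x∈Z
    grow Z x∈Z (cons f j W) (allowedF ∷ allowedW)
      with Z′ , y∈Z′ ← extend Z x∈Z allowedF j = grow Z′ y∈Z′ W allowedW

    closedTrailThrough : ∀ {u v} (W : Walk u v) → All Allowed (edges W) →
                         Σ[ Z ∈ ClosedTrail Allowed u ] v ∈ vertices (walk Z)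
    closedTrailThrough = grow (closedTrail nil [] []) (here refl)

  twice-χ-singleton∈lattice : ∀ e → (∀ f x y → Reach G (λ d → d ≢ e × d ≢ f) x y) →
                              InCycleLattice G (λ d → + 2 * χ G (singletonE G e) d)
  twice-χ-singleton∈lattice e connectedWithout
    with W , avoidsE ← toWalk (connectedWithout e (proj₁ (ends G e)) (proj₂ (ends G e)))
    with closedTrail Z trailZ avoids , v∈Z ← closedTrailThrough connectedWithout W (All.map proj₁ avoidsE)
    with Z₂ , Z₁ , refl ← splitAt Z v∈Z
    = lattice-resp twice (lattice-- (lattice-+ (closedTrail∈lattice C₁ trail₁) (closedTrail∈lattice C₂ trail₂))
                                    (closedTrail∈lattice (Z₂ ++ʷ Z₁) trailZ))
    where
    u v : V
    u = proj₁ (ends G e)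
    v = proj₂ (ends G e)
    C₁ : Walk u u
    C₁ = cons e (inj₁ refl) Z₁
    C₂ : Walk u u
    C₂ = Z₂ ++ʷ cons e (inj₂ refl) nil
    parts : Unique (edges Z₂) × Unique (edges Z₁) × Disjoint (edges Z₂) (edges Z₁)
    parts = trail-++ʷ⁻ Z₂ Z₁ trailZ
    e∉Z : ∀ {d} → d ∈ edges (Z₂ ++ʷ Z₁) → e ≢ d
    e∉Z d∈ refl = All.lookup avoids d∈ refl
    trail₁ : Unique (edges C₁)
    trail₁ = All.tabulate (e∉Z ∘ ∈-edges-++ʷʳ Z₂ Z₁) ∷ proj₁ (proj₂ parts)
    trail₂ : Unique (edges C₂)
    trail₂ = subst Unique (sym (edges-++ʷ Z₂ _))
      (++⁺ (proj₁ parts) ([] ∷ []) λ { (d∈ , here refl) → e∉Z (∈-edges-++ʷˡ Z₂ Z₁ d∈) refl })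
    twice : ∀ d → traversals C₁ d ℤ.+ traversals C₂ d ℤ.- traversals (Z₂ ++ʷ Z₁) d ≡ + 2 * χ G (singletonE G e) d
    twice d rewrite traversals-++ʷ Z₂ (cons e (inj₂ refl) nil) d | traversals-++ʷ Z₂ Z₁ d =
      ring (χ G (singletonE G e) d) (traversals Z₁ d) (traversals Z₂ d)
      where
      ring : ∀ x t₁ t₂ → (x ℤ.+ t₁) ℤ.+ (t₂ ℤ.+ (x ℤ.+ + 0)) ℤ.- (t₂ ℤ.+ t₁) ≡ + 2 * x
      ring = ℤSolver.solve-∀

  scaled∈lattice : ∀ k → (∀ e → InCycleLattice G (λ d → k * χ G (singletonE G e) d)) →
                   ∀ (y : E → ℤ) → InCycleLattice G (λ d → k * y d)
  scaled∈lattice k kχ∈ℒ y =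
    lattice-resp expand (lattice-∑ (λ i d → y i * (k * χ G (singletonE G i) d)) (λ i → lattice-scale (y i) (kχ∈ℒ i)))
    where
    expand : ∀ d → ℤΣ.sum (λ i → y i * (k * χ G (singletonE G i) d)) ≡ k * y d
    expand d = trans (ℤΣ.sum-cong-≗ (λ i → reassociate k (y i) (χ G (singletonE G i) d)))
                     (basis-expansion (λ i → k * y i) d)
      where
      reassociate : ∀ k a x → a * (k * x) ≡ (k * a) * x
      reassociate = ℤSolver.solve-∀

lemma3p1 : (G : Graph) → ThreeEdgeConnected G →
    (∀ (e : Edge G) → InCycleLattice G (λ d → + 2 * χ G (singletonE G e) d)) ×
    (∀ (y : Edge G → ℤ) → InCycleLattice G (λ d → + 2 * y d))
lemma3p1 G (_ , connectedWithout) = twiceχ∈ℒ , scaled∈lattice G (+ 2) twiceχ∈ℒ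
  where
  twiceχ∈ℒ : ∀ e → InCycleLattice G (λ d → + 2 * χ G (singletonE G e) d)
  twiceχ∈ℒ e = twice-χ-singleton∈lattice G e (connectedWithout e)
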